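{- Let $p$ be an odd prime, $\alpha$ a primitive root modulo $p$, and $\mathcal{R}_p=\{(i,j)\in\mathbb{Z}^2:\alpha^j\equiv i\bmod p\}$. Let $(i,j)\in\mathbb{Z}^2$ be such that $(i,j)\in\mathcal{R}_p$ and $(i+1,j+1)\in\mathcal{R}_p$, let $S=\{i,\dots,i+p-1\}\times\{j,\dots,j+p-2\}$, and let $\mathcal{B}=(\mathcal{R}_p\cap S)\cup\{(i,j+p-1),(i+p,j),(i+p+1,j+p)\}$. Then every vector $(d,e)$ with $d,e$ non-zero integers satisfying $|d|\le p-1$ and $|e|\le p-2$ can be expressed as the sum of two difference vectors of $\mathcal{B}$.
   Context: A difference vector of $\mathcal{B}$ is a vector $\mathbf{x}-\mathbf{y}$ with $\mathbf{x},\mathbf{y}\in\mathcal{B}$, $\mathbf{x}\ne\mathbf{y}$. -}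

module Defs where

open import Data.Nat as ℕ using (ℕ; suc)
open import Data.Integer using (ℤ; +_; -[1+_]; _+_; _-_; _*_; _^_; _≤_)
open import Data.Integer.Divisibility using (_∣_)
open import Data.Product using (_×_; _,_; ∃-syntax)
open import Data.Sum using (_⊎_)
open import Relation.Nullary using (¬_)
open import Relation.Binary.PropositionalEquality using (_≡_; _≢_)

infix 4 _≡ₚ_[mod_]
_≡ₚ_[mod_] : ℤ → ℤ → ℕ → Set
a ≡ₚ b [mod m ] = (+ m) ∣ (a - b)

IsPrimitiveRoot : ℕ → ℤ → Set
IsPrimitiveRoot p α =
  (α ^ (p ℕ.∸ 1) ≡ₚ + 1 [mod p ]) ×
  (∀ (k : ℕ) → 1 ℕ.≤ k → k ℕ.< p ℕ.∸ 1 → ¬ (α ^ k ≡ₚ + 1 [mod p ]))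

-- "α^j ≡ i (mod p)" for an integer exponent j.
-- For j ≥ 0 this is literal; for j = -(n+1) < 0, α^j denotes the (n+1)-th
-- power of the inverse of α mod p, so α^j ≡ i iff α^(n+1) * i ≡ 1 (mod p).
PowCong : ℕ → ℤ → ℤ → ℤ → Set
PowCong p α (+ n)     i = α ^ n ≡ₚ i [mod p ]
PowCong p α -[1+ n ]  i = (α ^ suc n) * i ≡ₚ + 1 [mod p ]

InR : ℕ → ℤ → ℤ × ℤ → Set
InR p α (i , j) = PowCong p α j i

InS : ℕ → ℤ × ℤ → ℤ × ℤ → Set
InS p (i , j) (a , b) =
  (i ≤ a × a ≤ i + + p - + 1) × (j ≤ b × b ≤ j + + p - + 2)

InB : ℕ → ℤ → ℤ × ℤ → ℤ × ℤ → Set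
InB p α (i , j) x =
  (InR p α x × InS p (i , j) x)
  ⊎ (x ≡ (i , j + + p - + 1))
  ⊎ (x ≡ (i + + p , j))
  ⊎ (x ≡ (i + + p + + 1 , j + + p))

_⊕_ : ℤ × ℤ → ℤ × ℤ → ℤ × ℤ
(a , b) ⊕ (c , d) = (a + c , b + d)

_⊖_ : ℤ × ℤ → ℤ × ℤ → ℤ × ℤ
(a , b) ⊖ (c , d) = (a - c , b - d)

IsDifferenceVector : (ℤ × ℤ → Set) → ℤ × ℤ → Set
IsDifferenceVector B v = ∃[ x ] ∃[ y ] (B x × B y × x ≢ y × v ≡ x ⊖ y)

-- Rows j, …, j + p - 2 of R_p ∩ S each contain exactly one point, in row j + t at the column
-- where i + r ≡ α^t i (mod p).  For a target (d, e), let e′ ≡ e (mod p - 1) and pick s with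
-- i (α^e′ - 1) α^s ≡ d (mod p): such s exists because i (α^e′ - 1) ≢ 0 and the powers of a
-- primitive root run through all non-zero classes.  The points in rows s and s + e′ (mod p - 1)
-- then differ by a vector agreeing with (d, e) modulo (p, p - 1), and by the size bounds the error
-- lies in {0, ±p} × {0, ±(p - 1)}.  Each non-zero error is a difference of two of
-- (i, j), (i + 1, j + 1) and the three extra points; a zero error is absorbed by splitting the
-- row difference through (i, j + p - 1).
module Submission where

open import Defs
open import Data.Nat as ℕ using (ℕ)
open import Data.Nat.Primality using (Prime)
open import Data.Nat.Divisibility as ℕD using ()
open import Data.Integer using (ℤ; +_; _+_; _-_; ∣_∣)
open import Data.Product using (_×_; _,_; ∃-syntax)
open import Relation.Nullary using (¬_)
open import Relation.Binary.PropositionalEquality using (_≡_; _≢_)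

open import Data.Nat using (zero; suc)
import Data.Nat.Properties as ℕP
import Data.Nat.DivMod as ℕDM
open import Data.Nat.Primality using (euclidsLemma; ¬prime[0]; ¬prime[1])
open import Data.Integer using (-_; _*_; _^_; _≤_; +≤+; -[1+_]; 0ℤ; 1ℤ)
import Data.Integer.Properties as ℤP
open import Data.Integer.DivMod using (_%ℕ_; _/ℕ_; n%ℕd<d; a≡a%ℕn+[a/ℕn]*n)
open import Data.Integer.Divisibility.Signed
  using (_∣_; divides; ∣ᵤ⇒∣; ∣⇒∣ᵤ; ∣m∣n⇒∣m+n; ∣m⇒∣-m; ∣n⇒∣m*n)
open import Data.Integer.Tactic.RingSolver using (solve-∀)
open import Data.Fin using (Fin; toℕ; fromℕ<; punchOut)
import Data.Fin.Properties as FP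
open import Data.Product using (proj₁; proj₂)
open import Data.Sum as Sum using (_⊎_; inj₁; inj₂)
open import Data.Empty using (⊥; ⊥-elim)
open import Function using (_∘_)
open import Function.Definitions using (Injective)
open import Relation.Nullary using (yes; no)
open import Relation.Binary.Bundles using (Setoid)
open import Relation.Binary.Structures using (IsEquivalence)
open import Relation.Binary.Definitions using (tri<; tri≈; tri>)
open import Relation.Binary.PropositionalEquality
  using (refl; sym; trans; cong; cong₂; subst; subst₂; module ≡-Reasoning)
import Relation.Binary.Reasoning.Setoid as SetoidReasoning

punchOut∘-injective : ∀ {m n} {f : Fin m → Fin (suc n)} {z} (z∉f : ∀ x → z ≢ f x) →
                      Injective _≡_ _≡_ f → Injective _≡_ _≡_ (λ x → punchOut (z∉f x))
punchOut∘-injective z∉f f-inj eq = f-inj (FP.punchOut-injective (z∉f _) (z∉f _) eq)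

injection-misses-one : ∀ {n} {f : Fin n → Fin (suc n)} {z c} → Injective _≡_ _≡_ f →
                       z ≢ c → (∀ x → z ≢ f x) → (∀ x → c ≢ f x) → ⊥
injection-misses-one {zero} {z = Fin.zero} {Fin.zero} _ z≢c _ _ = z≢c refl
injection-misses-one {suc n} {f} {z} {c} f-inj z≢c z∉f c∉f =
  ℕP.1+n≰n (FP.injective⇒≤ (punchOut∘-injective c′∉g (punchOut∘-injective z∉f f-inj)))
  where
  c′∉g : ∀ x → punchOut z≢c ≢ punchOut (z∉f x)
  c′∉g x eq = c∉f x (FP.punchOut-injective z≢c (z∉f x) eq)

injection-hits-all-but-one : ∀ {n} {f : Fin n → Fin (suc n)} → Injective _≡_ _≡_ f →
                             ∀ {z c} → z ≢ c → (∀ x → z ≢ f x) → ∃[ x ] f x ≡ c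
injection-hits-all-but-one {f = f} f-inj {z} {c} z≢c z∉f with FP.any? (λ x → f x FP.≟ c)
... | yes hit  = hit
... | no  miss = ⊥-elim (injection-misses-one f-inj z≢c z∉f (λ x c≡fx → miss (x , sym c≡fx)))

data ZeroOrPlusMinus (m : ℤ) : ℤ → Set where
  zero  : ZeroOrPlusMinus m 0ℤ
  plus  : ZeroOrPlusMinus m m
  minus : ZeroOrPlusMinus m (- m)

∣[+a]-[+b]∣<m : ∀ {a b m} → a ℕ.< m → b ℕ.< m → ∣ + a - + b ∣ ℕ.< m
∣[+a]-[+b]∣<m {a} {b} a<m b<m = ℕP.≤-<-trans ∣a-b∣≤a⊔b (ℕP.⊔-pres-<m a<m b<m)
  where
  ∣a-b∣≤a⊔b : ∣ + a - + b ∣ ℕ.≤ a ℕ.⊔ b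
  ∣a-b∣≤a⊔b = subst (ℕ._≤ a ℕ.⊔ b) (cong ∣_∣ (sym (ℤP.[+m]-[+n]≡m⊖n a b))) (ℤP.∣m⊝n∣≤m⊔n a b)

module Congruence (m : ℕ) where

  infix 4 _≈_
  record _≈_ (a b : ℤ) : Set where
    constructor ∣-difference
    field divides-difference : + m ∣ a - b

  ≈-by : ∀ {a b x} → + m ∣ x → x ≡ a - b → a ≈ b
  ≈-by m∣x refl = ∣-difference m∣x

  ≈-refl : ∀ {a} → a ≈ a
  ≈-refl {a} = ≈-by (divides 0ℤ refl) (sym (ℤP.+-inverseʳ a))

  ≈-sym : ∀ {a b} → a ≈ b → b ≈ a
  ≈-sym {a} {b} (∣-difference m∣a-b) = ≈-by (∣m⇒∣-m m∣a-b) (identity a b)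
    where identity : ∀ a b → - (a - b) ≡ b - a
          identity = solve-∀

  ≈-trans : ∀ {a b c} → a ≈ b → b ≈ c → a ≈ c
  ≈-trans {a} {b} {c} (∣-difference m∣a-b) (∣-difference m∣b-c) =
    ≈-by (∣m∣n⇒∣m+n m∣a-b m∣b-c) (identity a b c)
    where identity : ∀ a b c → (a - b) + (b - c) ≡ a - c
          identity = solve-∀

  ≈-reflexive : ∀ {a b} → a ≡ b → a ≈ b
  ≈-reflexive refl = ≈-refl

  ≈-isEquivalence : IsEquivalence _≈_
  ≈-isEquivalence = record { refl = ≈-refl ; sym = ≈-sym ; trans = ≈-trans }

  ≈-setoid : Setoid _ _
  ≈-setoid = record { isEquivalence = ≈-isEquivalence }

  +-cong : ∀ {a b c d} → a ≈ b → c ≈ d → a + c ≈ b + d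
  +-cong {a} {b} {c} {d} (∣-difference m∣a-b) (∣-difference m∣c-d) =
    ≈-by (∣m∣n⇒∣m+n m∣a-b m∣c-d) (identity a b c d)
    where identity : ∀ a b c d → (a - b) + (c - d) ≡ (a + c) - (b + d)
          identity = solve-∀

  -‿cong : ∀ {a b} → a ≈ b → - a ≈ - b
  -‿cong {a} {b} (∣-difference m∣a-b) = ≈-by (∣m⇒∣-m m∣a-b) (identity a b)
    where identity : ∀ a b → - (a - b) ≡ - a - - b
          identity = solve-∀

  -‿cong₂ : ∀ {a b c d} → a ≈ b → c ≈ d → a - c ≈ b - d
  -‿cong₂ a≈b c≈d = +-cong a≈b (-‿cong c≈d)

  *-cong : ∀ {a b c d} → a ≈ b → c ≈ d → a * c ≈ b * d
  *-cong {a} {b} {c} {d} (∣-difference m∣a-b) (∣-difference m∣c-d) =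
    ≈-by (∣m∣n⇒∣m+n (∣n⇒∣m*n c m∣a-b) (∣n⇒∣m*n b m∣c-d)) (identity a b c d)
    where identity : ∀ a b c d → c * (a - b) + b * (c - d) ≡ a * c - b * d
          identity = solve-∀

  ^-cong : ∀ {a b} k → a ≈ b → a ^ k ≈ b ^ k
  ^-cong ℕ.zero    a≈b = ≈-refl
  ^-cong (ℕ.suc k) a≈b = *-cong a≈b (^-cong k a≈b)

  ≈⇒-≈0 : ∀ {a b} → a ≈ b → a - b ≈ 0ℤ
  ≈⇒-≈0 {b = b} a≈b = ≈-trans (-‿cong₂ a≈b (≈-refl {b})) (≈-reflexive (ℤP.+-inverseʳ b))

  -≈0⇒≈ : ∀ {a b} → a - b ≈ 0ℤ → a ≈ b
  -≈0⇒≈ {a} {b} (∣-difference m∣a-b-0) = ≈-by m∣a-b-0 (ℤP.+-identityʳ (a - b))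

  ≡ₚ⇒≈ : ∀ a b → a ≡ₚ b [mod m ] → a ≈ b
  ≡ₚ⇒≈ _ _ = ∣-difference ∘ ∣ᵤ⇒∣

  ≈⇒≡ₚ : ∀ {a b} → a ≈ b → a ≡ₚ b [mod m ]
  ≈⇒≡ₚ (∣-difference m∣a-b) = ∣⇒∣ᵤ m∣a-b

  module _ {x : ℤ} where
    ≈0⇒∣∣ : x ≈ 0ℤ → m ℕD.∣ ∣ x ∣
    ≈0⇒∣∣ (∣-difference m∣x-0) = subst (λ y → m ℕD.∣ ∣ y ∣) (ℤP.+-identityʳ x) (∣⇒∣ᵤ m∣x-0)

    ∣∣⇒≈0 : m ℕD.∣ ∣ x ∣ → x ≈ 0ℤ
    ∣∣⇒≈0 m∣∣x∣ = ≈-by (∣ᵤ⇒∣ m∣∣x∣) (sym (ℤP.+-identityʳ x))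

    small-nonzero⇒≉0 : x ≢ 0ℤ → ∣ x ∣ ℕ.< m → ¬ x ≈ 0ℤ
    small-nonzero⇒≉0 x≢0 ∣x∣<m x≈0 = ℕP.<⇒≱ ∣x∣<m (ℕD.∣⇒≤ ⦃ ℕ.≢-nonZero ∣x∣≢0 ⦄ (≈0⇒∣∣ x≈0))
      where ∣x∣≢0 = x≢0 ∘ ℤP.∣i∣≡0⇒i≡0

  close-congruent⇒ZeroOrPlusMinus : ∀ {x y} → ∣ x ∣ ℕ.< m → ∣ y ∣ ℕ.< m → x ≈ y →
                                    ZeroOrPlusMinus (+ m) (x - y)
  close-congruent⇒ZeroOrPlusMinus {x} {y} ∣x∣<m ∣y∣<m (∣-difference (divides q eq)) = classify q eq
    where
    ∣x-y∣<2m : ∣ x - y ∣ ℕ.< m ℕ.+ m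
    ∣x-y∣<2m = ℕP.≤-<-trans (ℤP.∣i-j∣≤∣i∣+∣j∣ x y) (ℕP.+-mono-< ∣x∣<m ∣y∣<m)
    ∣x-y∣≢[2+q]m : ∀ q → ∣ x - y ∣ ≢ suc (suc q) ℕ.* m
    ∣x-y∣≢[2+q]m q eq = ℕP.<⇒≱ ∣x-y∣<2m
      (subst (m ℕ.+ m ℕ.≤_) (sym eq) (ℕP.+-monoʳ-≤ m (ℕP.m≤m+n m (q ℕ.* m))))
    classify : ∀ q → x - y ≡ q * + m → ZeroOrPlusMinus (+ m) (x - y)
    classify (+ 0)           eq = subst (ZeroOrPlusMinus (+ m)) (sym eq) zero
    classify (+ 1)           eq = subst (ZeroOrPlusMinus (+ m)) (sym (trans eq (ℤP.*-identityˡ (+ m)))) plus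
    classify -[1+ 0 ]        eq = subst (ZeroOrPlusMinus (+ m)) (sym (trans eq (ℤP.-1*i≡-i (+ m)))) minus
    classify q@(+ suc (suc r)) eq = ⊥-elim (∣x-y∣≢[2+q]m r (trans (cong ∣_∣ eq) (ℤP.abs-* q (+ m))))
    classify q@(-[1+ suc r ])  eq = ⊥-elim (∣x-y∣≢[2+q]m r (trans (cong ∣_∣ eq) (ℤP.abs-* q (+ m))))

  module _ .⦃ _ : ℕ.NonZero m ⦄ where
    ≈-%ℕ : ∀ z → z ≈ + (z %ℕ m)
    ≈-%ℕ z = ≈-by (divides (z /ℕ m) refl) (sym (begin
        z - + r                       ≡⟨ cong (_- + r) (a≡a%ℕn+[a/ℕn]*n z m) ⟩
        (+ r + (z /ℕ m) * + m) - + r  ≡⟨ cancel (+ r) _ ⟩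
        (z /ℕ m) * + m                ∎))
      where
      open ≡-Reasoning
      r = z %ℕ m
      cancel : ∀ a b → (a + b) - a ≡ b
      cancel = solve-∀

    residue : ℤ → Fin m
    residue z = fromℕ< (n%ℕd<d z m)

    residue-≡⇒≈ : ∀ {a b} → residue a ≡ residue b → a ≈ b
    residue-≡⇒≈ {a} {b} eq = begin
      a              ≈⟨ ≈-%ℕ a ⟩
      + (a %ℕ m)     ≡⟨ cong +_ %-eq ⟩
      + (b %ℕ m)     ≈⟨ ≈-%ℕ b ⟨
      b              ∎
      where
      open SetoidReasoning ≈-setoid
      %-eq : a %ℕ m ≡ b %ℕ m
      %-eq = trans (sym (FP.toℕ-fromℕ< _)) (trans (cong toℕ eq) (FP.toℕ-fromℕ< _))

module ModuloPrime (p : ℕ) (isPrime : Prime p) where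
  open Congruence p

  1≉0 : ¬ 1ℤ ≈ 0ℤ
  1≉0 1≈0 = ¬prime[1] (subst Prime (ℕD.∣1⇒≡1 (≈0⇒∣∣ 1≈0)) isPrime)

  *≈0⇒≈0⊎≈0 : ∀ x y → x * y ≈ 0ℤ → x ≈ 0ℤ ⊎ y ≈ 0ℤ
  *≈0⇒≈0⊎≈0 x y xy≈0 =
    Sum.map ∣∣⇒≈0 ∣∣⇒≈0 (euclidsLemma ∣ x ∣ ∣ y ∣ isPrime (subst (p ℕD.∣_) (ℤP.abs-* x y) (≈0⇒∣∣ xy≈0)))

  *≈1⇒≉0 : ∀ {x y} → x * y ≈ 1ℤ → ¬ y ≈ 0ℤ
  *≈1⇒≉0 {x} {y} xy≈1 y≈0 = 1≉0 (begin
    1ℤ      ≈⟨ xy≈1 ⟨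
    x * y   ≈⟨ *-cong (≈-refl {x}) y≈0 ⟩
    x * 0ℤ  ≡⟨ ℤP.*-zeroʳ x ⟩
    0ℤ      ∎)
    where open SetoidReasoning ≈-setoid

  *-cancelˡ-≈ : ∀ {c x y} → ¬ c ≈ 0ℤ → c * x ≈ c * y → x ≈ y
  *-cancelˡ-≈ {c} {x} {y} c≉0 cx≈cy =
    Sum.[ ⊥-elim ∘ c≉0 , -≈0⇒≈ ]′
      (*≈0⇒≈0⊎≈0 c (x - y) (≈-trans (≈-reflexive (distrib c x y)) (≈⇒-≈0 cx≈cy)))
    where distrib : ∀ c x y → c * (x - y) ≡ c * x - c * y
          distrib = solve-∀

module PrimitiveRoot (k : ℕ) (isPrime : Prime (suc (suc k)))
                     (α : ℤ) (root : IsPrimitiveRoot (suc (suc k)) α) where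
  p n : ℕ
  p = suc (suc k)
  n = suc k

  open Congruence p
  open ModuloPrime p isPrime
  open SetoidReasoning ≈-setoid

  α^n≈1 : α ^ n ≈ 1ℤ
  α^n≈1 = ≡ₚ⇒≈ (α ^ n) 1ℤ (proj₁ root)

  α^t≉1 : ∀ {t} → 0 ℕ.< t → t ℕ.< n → ¬ α ^ t ≈ 1ℤ
  α^t≉1 0<t t<n = proj₂ root _ 0<t t<n ∘ ≈⇒≡ₚ

  α^[n*t]≈1 : ∀ t → α ^ (n ℕ.* t) ≈ 1ℤ
  α^[n*t]≈1 t = begin
    α ^ (n ℕ.* t)  ≡⟨ ℤP.^-*-assoc α n t ⟨
    (α ^ n) ^ t    ≈⟨ ^-cong t α^n≈1 ⟩
    1ℤ ^ t         ≡⟨ ℤP.^-zeroˡ t ⟩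
    1ℤ             ∎

  α^t≉0 : ∀ t → ¬ α ^ t ≈ 0ℤ
  α^t≉0 t = *≈1⇒≉0 {α ^ (k ℕ.* t)} (begin
    α ^ (k ℕ.* t) * α ^ t  ≡⟨ ℤP.*-comm (α ^ (k ℕ.* t)) (α ^ t) ⟩
    α ^ t * α ^ (k ℕ.* t)  ≡⟨ ℤP.^-distribˡ-+-* α t (k ℕ.* t) ⟨
    α ^ (n ℕ.* t)          ≈⟨ α^[n*t]≈1 t ⟩
    1ℤ                     ∎)

  α^[a%n]≈α^a : ∀ a → α ^ (a ℕ.% n) ≈ α ^ a
  α^[a%n]≈α^a a = begin
    α ^ (a ℕ.% n)                         ≡⟨ ℤP.*-identityʳ _ ⟨
    α ^ (a ℕ.% n) * 1ℤ                    ≈⟨ *-cong (≈-refl {α ^ (a ℕ.% n)}) (α^[n*t]≈1 (a ℕ./ n)) ⟨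
    α ^ (a ℕ.% n) * α ^ (n ℕ.* (a ℕ./ n))  ≡⟨ ℤP.^-distribˡ-+-* α (a ℕ.% n) _ ⟨
    α ^ (a ℕ.% n ℕ.+ n ℕ.* (a ℕ./ n))      ≡⟨ cong (λ q → α ^ (a ℕ.% n ℕ.+ q)) (ℕP.*-comm n (a ℕ./ n)) ⟩
    α ^ (a ℕ.% n ℕ.+ (a ℕ./ n) ℕ.* n)      ≡⟨ cong (α ^_) (ℕDM.m≡m%n+[m/n]*n a n) ⟨
    α ^ a                                 ∎

  α^a≉α^b : ∀ {a b} → a ℕ.< b → b ℕ.< n → ¬ α ^ a ≈ α ^ b
  α^a≉α^b {a} {b} a<b b<n α^a≈α^b =
    α^t≉1 (ℕP.m<n⇒0<n∸m a<b) (ℕP.≤-<-trans (ℕP.m∸n≤m b a) b<n) (*-cancelˡ-≈ (α^t≉0 a) (begin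
      α ^ a * α ^ (b ℕ.∸ a)  ≡⟨ ℤP.^-distribˡ-+-* α a (b ℕ.∸ a) ⟨
      α ^ (a ℕ.+ (b ℕ.∸ a))  ≡⟨ cong (α ^_) (ℕP.m+[n∸m]≡n (ℕP.<⇒≤ a<b)) ⟩
      α ^ b                  ≈⟨ α^a≈α^b ⟨
      α ^ a                  ≡⟨ ℤP.*-identityʳ (α ^ a) ⟨
      α ^ a * 1ℤ             ∎))

  α^-injective : ∀ {a b} → a ℕ.< n → b ℕ.< n → α ^ a ≈ α ^ b → a ≡ b
  α^-injective {a} {b} a<n b<n α^a≈α^b with ℕP.<-cmp a b
  ... | tri< a<b _ _ = ⊥-elim (α^a≉α^b a<b b<n α^a≈α^b)
  ... | tri≈ _ a≡b _ = a≡b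
  ... | tri> _ _ b<a = ⊥-elim (α^a≉α^b b<a a<n (≈-sym α^a≈α^b))

  -- The n = p - 1 classes c * α ^ t are distinct and non-zero, so they fill all p - 1 non-zero classes.
  *α^-hits-≉0 : ∀ {c d} → ¬ c ≈ 0ℤ → ¬ d ≈ 0ℤ → ∃[ t ] t ℕ.< n × c * α ^ t ≈ d
  *α^-hits-≉0 {c} {d} c≉0 d≉0 =
    let x , fx≡d = injection-hits-all-but-one f-injective 0≢d 0∉f
    in toℕ x , FP.toℕ<n x , residue-≡⇒≈ fx≡d
    where
    f : Fin n → Fin p
    f x = residue (c * α ^ toℕ x)
    f-injective : Injective _≡_ _≡_ f
    f-injective {x} {y} fx≡fy = FP.toℕ-injective
      (α^-injective (FP.toℕ<n x) (FP.toℕ<n y) (*-cancelˡ-≈ c≉0 (residue-≡⇒≈ fx≡fy)))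
    0∉f : ∀ x → residue 0ℤ ≢ f x
    0∉f x 0≡fx = Sum.[ c≉0 , α^t≉0 (toℕ x) ]′
      (*≈0⇒≈0⊎≈0 c (α ^ toℕ x) (≈-sym (residue-≡⇒≈ 0≡fx)))
    0≢d : residue 0ℤ ≢ residue d
    0≢d 0≡d = d≉0 (≈-sym (residue-≡⇒≈ 0≡d))

  PowCong-resp : ∀ b {a a′} → a ≈ a′ → PowCong p α b a → PowCong p α b a′
  PowCong-resp (+ t)    a≈a′ α^t≡a     = ≈⇒≡ₚ (≈-trans (≡ₚ⇒≈ (α ^ t) _ α^t≡a) a≈a′)
  PowCong-resp -[1+ t ] a≈a′ α^[1+t]a≡1 =
    ≈⇒≡ₚ (≈-trans (*-cong (≈-refl {α ^ suc t}) (≈-sym a≈a′)) (≡ₚ⇒≈ (α ^ suc t * _) 1ℤ α^[1+t]a≡1))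

  PowCong-suc : ∀ b {a} → PowCong p α b a → PowCong p α (b + 1ℤ) (α * a)
  PowCong-suc (+ t) {a} α^t≡a = ≈⇒≡ₚ (begin
    α ^ (t ℕ.+ 1)  ≡⟨ cong (α ^_) (ℕP.+-comm t 1) ⟩
    α * α ^ t      ≈⟨ *-cong (≈-refl {α}) (≡ₚ⇒≈ (α ^ t) a α^t≡a) ⟩
    α * a          ∎)
  PowCong-suc -[1+ 0 ] {a} α^1a≡1 = ≈⇒≡ₚ (begin
    1ℤ             ≈⟨ ≡ₚ⇒≈ (α ^ 1 * a) 1ℤ α^1a≡1 ⟨
    α ^ 1 * a      ≡⟨ cong (_* a) (ℤP.^-identityʳ α) ⟩
    α * a          ∎)
  PowCong-suc -[1+ suc t ] {a} α^[2+t]a≡1 = ≈⇒≡ₚ (begin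
    α ^ suc t * (α * a)  ≡⟨ rearrange (α ^ suc t) α a ⟩
    α ^ suc (suc t) * a  ≈⟨ ≡ₚ⇒≈ (α ^ suc (suc t) * a) 1ℤ α^[2+t]a≡1 ⟩
    1ℤ                   ∎)
    where rearrange : ∀ x α a → x * (α * a) ≡ (α * x) * a
          rearrange = solve-∀

  PowCong-shift : ∀ t b {a} → PowCong p α b a → PowCong p α (b + + t) (α ^ t * a)
  PowCong-shift zero    b {a} α^b≡a =
    subst₂ (PowCong p α) (sym (ℤP.+-identityʳ b)) (sym (ℤP.*-identityˡ a)) α^b≡a
  PowCong-shift (suc t) b {a} α^b≡a =
    subst₂ (PowCong p α) (trans (ℤP.+-assoc b (+ t) 1ℤ) (cong (λ u → b + + u) (ℕP.+-comm t 1)))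
      (sym (ℤP.*-assoc α (α ^ t) a))
      (PowCong-suc (b + + t) (PowCong-shift t b α^b≡a))

  PowCong⇒≉0 : ∀ b {a} → PowCong p α b a → ¬ a ≈ 0ℤ
  PowCong⇒≉0 (+ t)    {a} α^t≡a     a≈0 = α^t≉0 t (≈-trans (≡ₚ⇒≈ (α ^ t) a α^t≡a) a≈0)
  PowCong⇒≉0 -[1+ t ] {a} α^[1+t]a≡1 = *≈1⇒≉0 {α ^ suc t} (≡ₚ⇒≈ (α ^ suc t * a) 1ℤ α^[1+t]a≡1)

origin : ℤ × ℤ
origin = (0ℤ , 0ℤ)

neg : ℤ × ℤ → ℤ × ℤ
neg (a , b) = (- a , - b)

⊖-self : ∀ x → x ⊖ x ≡ origin
⊖-self (a , b) = cong₂ _,_ (ℤP.+-inverseʳ a) (ℤP.+-inverseʳ b)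

neg-⊖ : ∀ x y → neg (x ⊖ y) ≡ y ⊖ x
neg-⊖ (a , b) (c , d) = cong₂ _,_ (swap a c) (swap b d)
  where swap : ∀ a c → - (a - c) ≡ c - a
        swap = solve-∀

⊕-⊖-cancel : ∀ u w → u ⊕ (w ⊖ u) ≡ w
⊕-⊖-cancel (a , b) (c , d) = cong₂ _,_ (cancel a c) (cancel b d)
  where cancel : ∀ a c → a + (c - a) ≡ c
        cancel = solve-∀

⊖-via : ∀ x z y → x ⊖ y ≡ (x ⊖ z) ⊕ (z ⊖ y)
⊖-via (a , b) (e , f) (c , d) = cong₂ _,_ (via a e c) (via b f d)
  where via : ∀ a e c → a - c ≡ (a - e) + (e - c)
        via = solve-∀

⊖≡origin⇒≡ : ∀ {w u} → w ⊖ u ≡ origin → w ≡ u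
⊖≡origin⇒≡ {w} {u@(a , b)} w⊖u≡0 = begin
  w                ≡⟨ ⊕-⊖-cancel u w ⟨
  u ⊕ (w ⊖ u)      ≡⟨ cong (u ⊕_) w⊖u≡0 ⟩
  u ⊕ origin       ≡⟨ cong₂ _,_ (ℤP.+-identityʳ a) (ℤP.+-identityʳ b) ⟩
  u                ∎
  where open ≡-Reasoning

module _ {B : ℤ × ℤ → Set} where

  differenceVector : ∀ {x y} → B x → B y → x ≢ y → IsDifferenceVector B (x ⊖ y)
  differenceVector {x} {y} x∈B y∈B x≢y = x , y , x∈B , y∈B , x≢y , refl

  differenceVector-≢origin : ∀ {x y v} → B x → B y → x ⊖ y ≡ v → v ≢ origin → IsDifferenceVector B v
  differenceVector-≢origin {x} x∈B y∈B refl v≢0 =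
    differenceVector x∈B y∈B (λ { refl → v≢0 (⊖-self x) })

  neg-differenceVector : ∀ {v} → IsDifferenceVector B v → IsDifferenceVector B (neg v)
  neg-differenceVector (x , y , x∈B , y∈B , x≢y , refl) =
    subst (IsDifferenceVector B) (sym (neg-⊖ x y)) (differenceVector y∈B x∈B (x≢y ∘ sym))

module Construction (k : ℕ) (isPrime : Prime (3 ℕ.+ k)) (α : ℤ) (root : IsPrimitiveRoot (3 ℕ.+ k) α)
                    (i j : ℤ) (o∈R : InR (3 ℕ.+ k) α (i , j))
                    (o⁺∈R : InR (3 ℕ.+ k) α (i + + 1 , j + + 1)) where
  open PrimitiveRoot (suc k) isPrime α root
  open Congruence p
  open ModuloPrime p isPrime
  module Mod-n = Congruence n

  B : ℤ × ℤ → Set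
  B = InB p α (i , j)

  ∈S : ∀ {r t} → r ℕ.< p → t ℕ.< n → InS p (i , j) (i + + r , j + + t)
  ∈S {r} {t} r<p t<n =
    (ℤP.i≤i+j i (+ r) , subst (i + + r ≤_) (sym (ℤP.+-assoc i (+ p) (- + 1))) (offset-≤ i (ℕ.s≤s⁻¹ r<p))) ,
    (ℤP.i≤i+j j (+ t) , subst (j + + t ≤_) (sym (ℤP.+-assoc j (+ p) (- + 2))) (offset-≤ j (ℕ.s≤s⁻¹ t<n)))
    where offset-≤ : ∀ a {x y} → x ℕ.≤ y → a + + x ≤ a + + y
          offset-≤ a x≤y = ℤP.+-monoʳ-≤ a (+≤+ x≤y)

  o o⁺ top right corner : ℤ × ℤ
  o      = (i , j)
  o⁺     = (i + + 1 , j + + 1)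
  top    = (i , j + + p - + 1)
  right  = (i + + p , j)
  corner = (i + + p + + 1 , j + + p)

  o∈B : B o
  o∈B = inj₁ (o∈R , subst₂ (λ a b → InS p (i , j) (a , b)) (ℤP.+-identityʳ i) (ℤP.+-identityʳ j)
                      (∈S (ℕ.s≤s ℕ.z≤n) (ℕ.s≤s ℕ.z≤n)))

  o⁺∈B : B o⁺
  o⁺∈B = inj₁ (o⁺∈R , ∈S (ℕ.s≤s (ℕ.s≤s ℕ.z≤n)) (ℕ.s≤s (ℕ.s≤s ℕ.z≤n)))

  top∈B : B top
  top∈B = inj₂ (inj₁ refl)

  right∈B : B right
  right∈B = inj₂ (inj₂ (inj₁ refl))

  corner∈B : B corner
  corner∈B = inj₂ (inj₂ (inj₂ refl))

  -- abstracting over + p lets the solver treat it as a variable; + p - + 1 then reduces to + n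
  private
    up : ∀ a P → (a + P) - a ≡ P
    up = solve-∀
    up-1 : ∀ a P → (a + P - + 1) - a ≡ P - + 1
    up-1 = solve-∀
    down-1 : ∀ a P → a - (a + P - + 1) ≡ - (P - + 1)
    down-1 = solve-∀
    up-from-1 : ∀ a P → (a + P + + 1) - (a + + 1) ≡ P
    up-from-1 = solve-∀
    up-1-from-1 : ∀ a P → (a + P) - (a + + 1) ≡ P - + 1
    up-1-from-1 = solve-∀

  [0,n]∈ΔB : IsDifferenceVector B (0ℤ , + n)
  [0,n]∈ΔB = differenceVector-≢origin top∈B o∈B (cong₂ _,_ (ℤP.+-inverseʳ i) (up-1 j (+ p))) λ ()

  [p,0]∈ΔB : IsDifferenceVector B (+ p , 0ℤ)
  [p,0]∈ΔB = differenceVector-≢origin right∈B o∈B (cong₂ _,_ (up i (+ p)) (ℤP.+-inverseʳ j)) λ ()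

  [p,n]∈ΔB : IsDifferenceVector B (+ p , + n)
  [p,n]∈ΔB = differenceVector-≢origin corner∈B o⁺∈B
               (cong₂ _,_ (up-from-1 i (+ p)) (up-1-from-1 j (+ p))) λ ()

  [p,-n]∈ΔB : IsDifferenceVector B (+ p , - + n)
  [p,-n]∈ΔB = differenceVector-≢origin right∈B top∈B (cong₂ _,_ (up i (+ p)) (down-1 j (+ p))) λ ()

  correction : ∀ {X Y} → ZeroOrPlusMinus (+ p) X → ZeroOrPlusMinus (+ n) Y →
               (X , Y) ≡ origin ⊎ IsDifferenceVector B (X , Y)
  correction zero  zero  = inj₁ refl
  correction zero  plus  = inj₂ [0,n]∈ΔB
  correction zero  minus = inj₂ (neg-differenceVector [0,n]∈ΔB)
  correction plus  zero  = inj₂ [p,0]∈ΔB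
  correction minus zero  = inj₂ (neg-differenceVector [p,0]∈ΔB)
  correction plus  plus  = inj₂ [p,n]∈ΔB
  correction minus minus = inj₂ (neg-differenceVector [p,n]∈ΔB)
  correction plus  minus = inj₂ [p,-n]∈ΔB
  correction minus plus  = inj₂ (neg-differenceVector [p,-n]∈ΔB)

  column : ℕ → ℕ
  column t = (α ^ t * i - i) %ℕ p

  column<p : ∀ t → column t ℕ.< p
  column<p t = n%ℕd<d (α ^ t * i - i) p

  rowPoint : ℕ → ℤ × ℤ
  rowPoint t = (i + + column t , j + + t)

  rowDifference : ℕ → ℕ → ℤ × ℤ
  rowDifference s t = (+ column t - + column s , + t - + s)

  i+column≈α^t*i : ∀ t → i + + column t ≈ α ^ t * i
  i+column≈α^t*i t = begin
    i + + column t       ≈⟨ +-cong (≈-refl {i}) (≈-%ℕ (α ^ t * i - i)) ⟨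
    i + (α ^ t * i - i)  ≡⟨ cancel i (α ^ t * i) ⟩
    α ^ t * i            ∎
    where open SetoidReasoning ≈-setoid
          cancel : ∀ a b → a + (b - a) ≡ b
          cancel = solve-∀

  rowPoint∈B : ∀ {t} → t ℕ.< n → B (rowPoint t)
  rowPoint∈B {t} t<n =
    inj₁ (PowCong-resp (j + + t) (≈-sym (i+column≈α^t*i t)) (PowCong-shift t j o∈R) , ∈S (column<p t) t<n)

  rowPoint-⊖ : ∀ s t → rowPoint t ⊖ rowPoint s ≡ rowDifference s t
  rowPoint-⊖ s t = cong₂ _,_ (shift i (+ column t) (+ column s)) (shift j (+ t) (+ s))
    where shift : ∀ a x y → (a + x) - (a + y) ≡ x - y
          shift = solve-∀

  rowPoint≢top : ∀ {t} → t ℕ.< n → rowPoint t ≢ top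
  rowPoint≢top {t} t<n rowPoint≡top =
    ℕP.<⇒≢ t<n (ℤP.+-injective (begin
      + t                         ≡⟨ up j (+ t) ⟨
      (j + + t) - j               ≡⟨ cong ((_- j) ∘ proj₂) rowPoint≡top ⟩
      (j + + p - + 1) - j         ≡⟨ up-1 j (+ p) ⟩
      + n                         ∎))
    where open ≡-Reasoning

  row-pair : ∀ {d e} → ¬ d ≈ 0ℤ → ¬ e Mod-n.≈ 0ℤ →
             ∃[ s ] ∃[ t ] (s ℕ.< n × t ℕ.< n × d ≈ + column t - + column s × e Mod-n.≈ + t - + s)
  row-pair {d} {e} d≉0 e≉0 = s , t , s<n , ℕDM.m%n<n (s ℕ.+ e′) n , d≈ , e≈
    where
    e′ = e %ℕ n
    e≈e′ : e Mod-n.≈ + e′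
    e≈e′ = Mod-n.≈-%ℕ e
    0<e′ : 0 ℕ.< e′
    0<e′ = ℕP.n≢0⇒n>0 λ e′≡0 → e≉0 (Mod-n.≈-trans e≈e′ (Mod-n.≈-reflexive (cong +_ e′≡0)))
    c : ℤ
    c = i * (α ^ e′ - 1ℤ)
    c≉0 : ¬ c ≈ 0ℤ
    c≉0 c≈0 = Sum.[ PowCong⇒≉0 j o∈R , α^t≉1 0<e′ (n%ℕd<d e n) ∘ -≈0⇒≈ ]′ (*≈0⇒≈0⊎≈0 i _ c≈0)
    hit = *α^-hits-≉0 c≉0 d≉0
    s = proj₁ hit
    s<n = proj₁ (proj₂ hit)
    t = (s ℕ.+ e′) ℕ.% n
    d≈ : d ≈ + column t - + column s
    d≈ = begin
      d                                  ≈⟨ proj₂ (proj₂ hit) ⟨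
      c * α ^ s                          ≡⟨ expand i (α ^ s) (α ^ e′) ⟩
      α ^ s * α ^ e′ * i - α ^ s * i     ≡⟨ cong (λ x → x * i - α ^ s * i) (ℤP.^-distribˡ-+-* α s e′) ⟨
      α ^ (s ℕ.+ e′) * i - α ^ s * i     ≈⟨ -‿cong₂ (*-cong (α^[a%n]≈α^a (s ℕ.+ e′)) (≈-refl {i})) (≈-refl {α ^ s * i}) ⟨
      α ^ t * i - α ^ s * i              ≈⟨ -‿cong₂ (i+column≈α^t*i t) (i+column≈α^t*i s) ⟨
      (i + + column t) - (i + + column s) ≡⟨ cong proj₁ (rowPoint-⊖ s t) ⟩
      + column t - + column s            ∎
      where
      open SetoidReasoning ≈-setoid
      expand : ∀ i x y → i * (y - 1ℤ) * x ≡ x * y * i - x * i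
      expand = solve-∀
    e≈ : e Mod-n.≈ + t - + s
    e≈ = begin
      e                        ≈⟨ e≈e′ ⟩
      + e′                     ≡⟨ cancel (+ s) (+ e′) ⟨
      (+ s + + e′) - + s       ≈⟨ Mod-n.-‿cong₂ (Mod-n.≈-%ℕ (+ (s ℕ.+ e′))) (Mod-n.≈-refl {+ s}) ⟩
      + t - + s                ∎
      where
      open SetoidReasoning Mod-n.≈-setoid
      cancel : ∀ a b → (a + b) - a ≡ b
      cancel = solve-∀

  SumOfTwoDifferences : ℤ × ℤ → Set
  SumOfTwoDifferences w = ∃[ u ] ∃[ v ] (IsDifferenceVector B u × IsDifferenceVector B v × w ≡ u ⊕ v)

  from-row-pair : ∀ {d e s t} → ¬ d ≈ 0ℤ → ∣ d ∣ ℕ.< p → ∣ e ∣ ℕ.< n → s ℕ.< n → t ℕ.< n →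
                  d ≈ + column t - + column s → e Mod-n.≈ + t - + s → SumOfTwoDifferences (d , e)
  from-row-pair {d} {e} {s} {t} d≉0 ∣d∣<p ∣e∣<n s<n t<n d≈ e≈
    with correction
           (close-congruent⇒ZeroOrPlusMinus ∣d∣<p (∣[+a]-[+b]∣<m (column<p t) (column<p s)) d≈)
           (Mod-n.close-congruent⇒ZeroOrPlusMinus ∣e∣<n (∣[+a]-[+b]∣<m t<n s<n) e≈)
  ... | inj₂ c∈ΔB =
    rowDifference s t , (d , e) ⊖ rowDifference s t ,
    differenceVector-≢origin (rowPoint∈B t<n) (rowPoint∈B s<n) (rowPoint-⊖ s t)
      (λ δ≡0 → d≉0 (≈-trans d≈ (≈-reflexive (cong proj₁ δ≡0)))) ,
    c∈ΔB , sym (⊕-⊖-cancel (rowDifference s t) (d , e))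
  ... | inj₁ c≡0 =
    rowPoint t ⊖ top , top ⊖ rowPoint s ,
    differenceVector (rowPoint∈B t<n) top∈B (rowPoint≢top t<n) ,
    differenceVector top∈B (rowPoint∈B s<n) (rowPoint≢top s<n ∘ sym) ,
    (begin
      (d , e)                                  ≡⟨ ⊖≡origin⇒≡ c≡0 ⟩
      rowDifference s t                        ≡⟨ rowPoint-⊖ s t ⟨
      rowPoint t ⊖ rowPoint s                  ≡⟨ ⊖-via (rowPoint t) top (rowPoint s) ⟩
      (rowPoint t ⊖ top) ⊕ (top ⊖ rowPoint s)  ∎)
    where open ≡-Reasoning

  sum-of-two-differences : ∀ {d e} → d ≢ 0ℤ → e ≢ 0ℤ → ∣ d ∣ ℕ.≤ n → ∣ e ∣ ℕ.≤ suc k →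
                           SumOfTwoDifferences (d , e)
  sum-of-two-differences d≢0 e≢0 ∣d∣≤n ∣e∣≤k+1 =
    let s , t , s<n , t<n , d≈ , e≈ = row-pair d≉0 (Mod-n.small-nonzero⇒≉0 e≢0 (ℕ.s≤s ∣e∣≤k+1))
    in from-row-pair d≉0 (ℕ.s≤s ∣d∣≤n) (ℕ.s≤s ∣e∣≤k+1) s<n t<n d≈ e≈
    where d≉0 = small-nonzero⇒≉0 d≢0 (ℕ.s≤s ∣d∣≤n)

lemma6 : (p : ℕ) → Prime p → ¬ (2 ℕD.∣ p) → (α : ℤ) → IsPrimitiveRoot p α →
    (i j : ℤ) → InR p α (i , j) → InR p α (i + + 1 , j + + 1) →
    (d e : ℤ) → d ≢ + 0 → e ≢ + 0 → ∣ d ∣ ℕ.≤ p ℕ.∸ 1 → ∣ e ∣ ℕ.≤ p ℕ.∸ 2 →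
    ∃[ u ] ∃[ v ] (IsDifferenceVector (InB p α (i , j)) u ×
                   IsDifferenceVector (InB p α (i , j)) v ×
                   (d , e) ≡ u ⊕ v)
lemma6 (suc (suc (suc k))) isPrime _ α root i j o∈R o⁺∈R d e d≢0 e≢0 ∣d∣≤p-1 ∣e∣≤p-2 =
  Construction.sum-of-two-differences k isPrime α root i j o∈R o⁺∈R d≢0 e≢0 ∣d∣≤p-1 ∣e∣≤p-2
lemma6 2 _ odd = ⊥-elim (odd ℕD.∣-refl)
lemma6 1 isPrime = ⊥-elim (¬prime[1] isPrime)
lemma6 0 isPrime = ⊥-elim (¬prime[0] isPrime)
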